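{- In the setting described in the context, the two neighbouring adjacencies of any entangled adjacency of $\pi$ always have the same direction, and the number of MNS of $\pi$ is minimized when the direction of each entangled adjacency is chosen to be the same as that of its neighbours.
   Context: Fix genes $\Sigma_1$ and repeats $\Sigma_2\ni r_0$. A chromosome is a sequence $\pi=[x_0,\dots,x_{n+1}]$ of signed symbols ($x_i=\pm a$, $|x_i|=a$) with $x_0=+r_0$, $x_{n+1}=-r_0$, every gene occurring exactly once. Nodes: $(l(x_i),r(x_i))=(a^h,a^t)$ if $x_i=+a$, $(a^t,a^h)$ if $x_i=-a$. Adjacencies: the unordered pairs $\langle r(x_i),l(x_{i+1})\rangle$, $0\le i\le n$; $\mathcal{A}[\pi]$ is their multiset; $\pi$ is simple if no adjacency occurs twice. Setting: $\pi=[x_0,\dots,x_{n+1}]$ and $\tau=[y_0,\dots,y_{n+1}]$ are simple related chromosomes with $\mathcal{A}[\pi]=\mathcal{A}[\tau]$, every repeat occurring exactly twice in each, and $\tau$ containing both $+r$ and $-r$ for every repeat $r$. Identical adjacencies are matched by the unique bijection. If $\langle r(x_i),l(x_{i+1})\rangle$ is matched to $\langle r(y_j),l(y_{j+1})\rangle$, it is positive if $r(x_i)=r(y_j)\ne l(x_{i+1})=l(y_{j+1})$, negative if $r(x_i)=l(y_{j+1})\ne l(x_{i+1})=r(y_j)$, and entangled if $r(x_i)=l(x_{i+1})=r(y_j)=l(y_{j+1})$ (an entangled adjacency may be assigned either direction). An MNS is a maximal run of consecutive negative adjacencies of $\pi$. -}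

module Defs where

open import Data.Nat using (ℕ; zero; suc; _+_; _∸_; _≤_; _<_; _≤ᵇ_; _≡ᵇ_)
open import Data.Nat.ListAction using (sum)
open import Data.Bool using (Bool; true; false; _∧_; _∨_; if_then_else_)
open import Data.List using (List; map; upTo)
open import Data.Product using (Σ; ∃; _×_; _,_)
open import Data.Sum using (_⊎_)
open import Relation.Binary.PropositionalEquality using (_≡_; _≢_)

data Sign : Set where
  plus minus : Sign

data End : Set where
  head tail : End

data Dir : Set where
  pos neg : Dir

isNeg : Dir → Bool
isNeg pos = false
isNeg neg = true

isPos : Dir → Bool
isPos pos = true
isPos neg = false

-- Maximal negative strips (MNS) of a direction sequence d 0, …, d n
-- (the n+1 adjacencies of a chromosome [x_0, …, x_{n+1}]).

allNegFrom : (ℕ → Dir) → ℕ → ℕ → Bool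
allNegFrom d a zero    = isNeg (d a)
allNegFrom d a (suc k) = isNeg (d a) ∧ allNegFrom d (suc a) k

isMNS : (ℕ → Dir) → ℕ → ℕ → ℕ → Bool
isMNS d n a b =
  (a ≤ᵇ b) ∧ (b ≤ᵇ n) ∧ allNegFrom d a (b ∸ a)
  ∧ ((a ≡ᵇ 0) ∨ isPos (d (a ∸ 1)))
  ∧ ((b ≡ᵇ n) ∨ isPos (d (suc b)))

numMNS : (ℕ → Dir) → ℕ → ℕ
numMNS d n =
  sum (map (λ a → sum (map (λ b → if isMNS d n a b then 1 else 0) (upTo (suc n))))
           (upTo (suc n)))

module Chrom (Gene Rep : Set) (r₀ : Rep) where

  Symbol : Set
  Symbol = Gene ⊎ Rep

  SSym : Set
  SSym = Sign × Symbol

  ∣_∣ : SSym → Symbol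
  ∣ _ , a ∣ = a

  Extremity : Set
  Extremity = Symbol × End

  lft : SSym → Extremity
  lft (plus  , a) = a , head
  lft (minus , a) = a , tail

  rgt : SSym → Extremity
  rgt (plus  , a) = a , tail
  rgt (minus , a) = a , head

  -- A chromosome [x_0, …, x_{n+1}] is given by n and x : ℕ → SSym,
  -- of which only the values x 0, …, x (n+1) are relevant.
  record Chromosome : Set where
    field
      len   : ℕ
      sym   : ℕ → SSym
      first : sym 0 ≡ (plus , Data.Sum.inj₂ r₀)
      last  : sym (suc len) ≡ (minus , Data.Sum.inj₂ r₀)
      genesOnce : (g : Gene) →
        Σ ℕ λ i → i ≤ suc len × ∣ sym i ∣ ≡ Data.Sum.inj₁ g ×
          ((k : ℕ) → k ≤ suc len → ∣ sym k ∣ ≡ Data.Sum.inj₁ g → k ≡ i)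
  open Chromosome public

  OccursTwice : Chromosome → Rep → Set
  OccursTwice π r =
    Σ ℕ λ i → Σ ℕ λ j → i ≤ suc (len π) × j ≤ suc (len π) × i ≢ j ×
      ∣ sym π i ∣ ≡ Data.Sum.inj₂ r × ∣ sym π j ∣ ≡ Data.Sum.inj₂ r ×
      ((k : ℕ) → k ≤ suc (len π) → ∣ sym π k ∣ ≡ Data.Sum.inj₂ r → k ≡ i ⊎ k ≡ j)

  -- adjacency i (0 ≤ i ≤ n) is the unordered pair ⟨r(x_i), l(x_{i+1})⟩,
  -- represented by the ordered pair (r(x_i), l(x_{i+1}))
  adj : Chromosome → ℕ → Extremity × Extremity
  adj π i = rgt (sym π i) , lft (sym π (suc i))

  _≈ᵤ_ : Extremity × Extremity → Extremity × Extremity → Set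
  (p , q) ≈ᵤ (p' , q') = (p ≡ p' × q ≡ q') ⊎ (p ≡ q' × q ≡ p')

  Simple : Chromosome → Set
  Simple π = (i j : ℕ) → i ≤ len π → j ≤ len π → adj π i ≈ᵤ adj π j → i ≡ j

  -- 𝒜[π] = 𝒜[τ] as multisets: a bijection between the adjacency indices
  -- {0,…,n_π} and {0,…,n_τ} matching equal adjacencies
  SameAdjacencies : Chromosome → Chromosome → Set
  SameAdjacencies π τ =
    Σ (ℕ → ℕ) λ f → Σ (ℕ → ℕ) λ g →
      ((i : ℕ) → i ≤ len π → f i ≤ len τ × g (f i) ≡ i × adj π i ≈ᵤ adj τ (f i)) ×
      ((j : ℕ) → j ≤ len τ → g j ≤ len π × f (g j) ≡ j)

  ContainsBothSigns : Chromosome → Rep → Set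
  ContainsBothSigns τ r =
    (Σ ℕ λ j → j ≤ suc (len τ) × sym τ j ≡ (plus  , Data.Sum.inj₂ r)) ×
    (Σ ℕ λ j → j ≤ suc (len τ) × sym τ j ≡ (minus , Data.Sum.inj₂ r))

  Positive : Chromosome → Chromosome → ℕ → Set
  Positive π τ i = Σ ℕ λ j → j ≤ len τ ×
    rgt (sym π i) ≡ rgt (sym τ j) × lft (sym π (suc i)) ≡ lft (sym τ (suc j)) ×
    rgt (sym π i) ≢ lft (sym π (suc i))

  Negative : Chromosome → Chromosome → ℕ → Set
  Negative π τ i = Σ ℕ λ j → j ≤ len τ ×
    rgt (sym π i) ≡ lft (sym τ (suc j)) × lft (sym π (suc i)) ≡ rgt (sym τ j) ×
    rgt (sym π i) ≢ lft (sym π (suc i))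

  Entangled : Chromosome → Chromosome → ℕ → Set
  Entangled π τ i = Σ ℕ λ j → j ≤ len τ ×
    rgt (sym π i) ≡ lft (sym π (suc i)) × rgt (sym π i) ≡ rgt (sym τ j) ×
    rgt (sym π i) ≡ lft (sym τ (suc j))

  SameDirection : Chromosome → Chromosome → ℕ → ℕ → Set
  SameDirection π τ i k =
    (Positive π τ i × Positive π τ k) ⊎ (Negative π τ i × Negative π τ k)

  ValidAssignment : Chromosome → Chromosome → (ℕ → Dir) → Set
  ValidAssignment π τ d = (i : ℕ) → i ≤ len π →
    (Positive π τ i → d i ≡ pos) × (Negative π τ i → d i ≡ neg)

  FollowsNeighbours : Chromosome → Chromosome → (ℕ → Dir) → Set
  FollowsNeighbours π τ d = (i : ℕ) → i ≤ len π → Entangled π τ i →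
    d i ≡ d (i ∸ 1) × d i ≡ d (suc i)

module Submission where

-- An entangled adjacency i of π joins the two copies x_i, x_{i+1} of a repeat r, so these are the
-- only occurrences of r in π (in particular r ≠ r₀ and i is an inner adjacency), and its match in
-- τ joins the two copies y_j = x_i, y_{j+1} = x_{i+1} of r in τ. Both neighbours of i contain the
-- remaining extremity of r, which in τ occurs only as l(y_j) and r(y_{j+1}). Hence a positive
-- (negative) left neighbour is matched to adjacency j-1 (j+1) of τ and a positive (negative) right
-- neighbour to j+1 (j-1); the matching being injective, both neighbours have the same direction.
--
-- An MNS is determined by its first adjacency: a negative one preceded by a positive one or by
-- nothing. If d' differs from d only at adjacencies where d' agrees with both neighbours, every
-- such start of d' is a start of d, so d' has at most as many MNS as d.

open import Defs
open import Data.Bool using (true; false; T; if_then_else_)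
open import Data.Bool.Properties using (T-∧; T-∨)
open import Data.List using ([]; _∷_; map; upTo)
open import Data.List.Membership.Propositional using (_∈_)
open import Data.List.Membership.Propositional.Properties using (∈-upTo⁺)
import Data.List.Relation.Unary.All as All
open import Data.List.Relation.Unary.Any using (here; there)
open import Data.List.Relation.Unary.AllPairs using (_∷_)
open import Data.List.Relation.Unary.Unique.Propositional using (Unique)
open import Data.List.Relation.Unary.Unique.Propositional.Properties using (upTo⁺)
open import Data.Nat using (ℕ; zero; suc; _+_; _∸_; _≤_; _<_; z≤n; s≤s; _≤?_)
open import Data.Nat.ListAction using (sum)
open import Data.Nat.Properties
  using (≤ᵇ⇒≤; ≤⇒≤ᵇ; ≡ᵇ⇒≡; ≡⇒≡ᵇ; ≤-refl; ≤-trans; ≤-antisym; ≤-pred; n≤1+n; ≮⇒≥; <-cmp; <⇒≢;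
         m≤n⇒m<n∨m≡n; n≢0⇒n>0; suc-injective; +-suc; +-identityʳ; +-comm; +-mono-≤; m≤m+n; m≤n+m;
         m+[n∸m]≡n)
open import Data.Product using (∃-syntax; _×_; _,_; proj₁; proj₂)
open import Data.Sum as Sum using (_⊎_; inj₁; inj₂)
open import Function.Bundles using (Equivalence)
open import Relation.Binary.Definitions using (DecidableEquality; tri<; tri≈; tri>)
open import Relation.Binary.PropositionalEquality using (_≡_; _≢_; refl; sym; trans; cong; subst)
open import Relation.Nullary using (¬_; Dec; yes; no; contradiction)
open import Relation.Nullary.Decidable using (_×-dec_; decidable-stable)

open Equivalence using (to; from)

_≟ᴰ_ : DecidableEquality Dir
pos ≟ᴰ pos = yes refl
pos ≟ᴰ neg = no λ ()
neg ≟ᴰ pos = no λ ()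
neg ≟ᴰ neg = yes refl

T-isNeg : ∀ {x} → T (isNeg x) → x ≡ neg
T-isNeg {neg} _ = refl

isNeg-T : ∀ {x} → x ≡ neg → T (isNeg x)
isNeg-T refl = _

T-isPos : ∀ {x} → T (isPos x) → x ≡ pos
T-isPos {pos} _ = refl

isPos-T : ∀ {x} → x ≡ pos → T (isPos x)
isPos-T refl = _

module _ {A : Set} where

  sum-map-mono : ∀ {f g : A → ℕ} → (∀ x → f x ≤ g x) → ∀ xs → sum (map f xs) ≤ sum (map g xs)
  sum-map-mono f≤g []       = z≤n
  sum-map-mono f≤g (x ∷ xs) = +-mono-≤ (f≤g x) (sum-map-mono f≤g xs)

  sum-map-positive⁻ : ∀ {f : A → ℕ} xs → 0 < sum (map f xs) → ∃[ x ] x ∈ xs × 0 < f x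
  sum-map-positive⁻ {f} (x ∷ xs) 0<sum with f x in fx≡
  ... | zero  = let y , y∈ , 0<fy = sum-map-positive⁻ xs 0<sum in y , there y∈ , 0<fy
  ... | suc _ = x , here refl , subst (0 <_) (sym fx≡) (s≤s z≤n)

  sum-map-positive⁺ : ∀ {f : A → ℕ} {x xs} → x ∈ xs → 0 < f x → 0 < sum (map f xs)
  sum-map-positive⁺ (here refl) 0<fx = ≤-trans 0<fx (m≤m+n _ _)
  sum-map-positive⁺ {f} (there x∈) 0<fx = ≤-trans (sum-map-positive⁺ x∈ 0<fx) (m≤n+m _ (f _))

  sum-map-≤1 : ∀ {f : A → ℕ} {xs} → Unique xs → (∀ x → f x ≤ 1) →
               (∀ {x y} → 0 < f x → 0 < f y → x ≡ y) → sum (map f xs) ≤ 1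
  sum-map-≤1 {xs = []} _ _ _ = z≤n
  sum-map-≤1 {f} {x ∷ xs} (x∉xs ∷ uniq) f≤1 unique with f x in fx≡
  ... | zero  = sum-map-≤1 uniq f≤1 unique
  ... | suc _ = +-mono-≤ (subst (_≤ 1) fx≡ (f≤1 x)) (≮⇒≥ rest-positive-absurd)
    where
    rest-positive-absurd : ¬ 0 < sum (map f xs)
    rest-positive-absurd 0<rest =
      let y , y∈ , 0<fy = sum-map-positive⁻ xs 0<rest
      in All.lookup x∉xs y∈ (unique (subst (0 <_) (sym fx≡) (s≤s z≤n)) 0<fy)

if-≤1 : ∀ b → (if b then 1 else 0) ≤ 1
if-≤1 true  = ≤-refl
if-≤1 false = z≤n

if-positive⁻ : ∀ {b} → 0 < (if b then 1 else 0) → T b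
if-positive⁻ {true} _ = _

if-positive⁺ : ∀ {b} → T b → 0 < (if b then 1 else 0)
if-positive⁺ {true} _ = ≤-refl

-- Maximal negative strips of a direction sequence

NegativeOn : (ℕ → Dir) → ℕ → ℕ → Set
NegativeOn d a b = ∀ k → a ≤ k → k ≤ b → d k ≡ neg

record MNS (d : ℕ → Dir) (n a b : ℕ) : Set where
  field
    a≤b          : a ≤ b
    b≤n          : b ≤ n
    negative     : NegativeOn d a b
    leftMaximal  : a ≡ 0 ⊎ d (a ∸ 1) ≡ pos
    rightMaximal : b ≡ n ⊎ d (suc b) ≡ pos

StartsMNS : (ℕ → Dir) → ℕ → Set
StartsMNS d a = d a ≡ neg × (a ≡ 0 ⊎ d (a ∸ 1) ≡ pos)

T-allNegFrom : ∀ {d} a k → T (allNegFrom d a k) → NegativeOn d a (a + k)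
T-allNegFrom a zero    t j a≤j j≤a+0 with refl ← ≤-antisym a≤j (subst (j ≤_) (+-identityʳ a) j≤a+0) = T-isNeg t
T-allNegFrom a (suc k) t j a≤j j≤ with to T-∧ t | m≤n⇒m<n∨m≡n a≤j
... | da , rest | inj₁ a<j  = T-allNegFrom (suc a) k rest j a<j (subst (j ≤_) (+-suc a k) j≤)
... | da , rest | inj₂ refl = T-isNeg da

allNegFrom-T : ∀ {d} a k → NegativeOn d a (a + k) → T (allNegFrom d a k)
allNegFrom-T a zero    negs = isNeg-T (negs a ≤-refl (m≤m+n a 0))
allNegFrom-T a (suc k) negs = from T-∧
  ( isNeg-T (negs a ≤-refl (m≤m+n a (suc k)))
  , allNegFrom-T (suc a) k λ j a<j j≤ → negs j (≤-trans (n≤1+n a) a<j) (subst (j ≤_) (sym (+-suc a k)) j≤) )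

T-isMNS : ∀ {d n a b} → T (isMNS d n a b) → MNS d n a b
T-isMNS {d} {n} {a} {b} t
  with a≤ᵇb , t₁ ← to T-∧ t
  with b≤ᵇn , t₂ ← to T-∧ t₁
  with negs , t₃ ← to T-∧ t₂
  with left , right ← to T-∧ t₃
  = record
  { a≤b          = a≤b
  ; b≤n          = ≤ᵇ⇒≤ b n b≤ᵇn
  ; negative     = subst (NegativeOn d a) (m+[n∸m]≡n a≤b) (T-allNegFrom a (b ∸ a) negs)
  ; leftMaximal  = Sum.map (≡ᵇ⇒≡ a 0) T-isPos (to T-∨ left)
  ; rightMaximal = Sum.map (≡ᵇ⇒≡ b n) T-isPos (to T-∨ right)
  }
  where a≤b = ≤ᵇ⇒≤ a b a≤ᵇb

isMNS-T : ∀ {d n a b} → MNS d n a b → T (isMNS d n a b)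
isMNS-T {d} {n} {a} {b} m = from T-∧
  ( ≤⇒≤ᵇ a≤b , from T-∧
  ( ≤⇒≤ᵇ b≤n , from T-∧
  ( allNegFrom-T a (b ∸ a) (subst (NegativeOn d a) (sym (m+[n∸m]≡n a≤b)) negative) , from T-∧
  ( from T-∨ (Sum.map (≡⇒≡ᵇ a 0) isPos-T leftMaximal)
  , from T-∨ (Sum.map (≡⇒≡ᵇ b n) isPos-T rightMaximal) ))))
  where open MNS m

mns-starts : ∀ {d n a b} → MNS d n a b → StartsMNS d a
mns-starts m = negative _ ≤-refl a≤b , leftMaximal
  where open MNS m

mns-not-shorter : ∀ {d n a b b'} → MNS d n a b → MNS d n a b' → ¬ b < b'
mns-not-shorter m m' b<b' with MNS.rightMaximal m
... | inj₁ refl = <⇒≢ (≤-trans b<b' (MNS.b≤n m')) refl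
... | inj₂ pos≡ with () ← trans (sym pos≡) (MNS.negative m' _ (≤-trans (MNS.a≤b m) (n≤1+n _)) b<b')

mns-end-unique : ∀ {d n a b b'} → MNS d n a b → MNS d n a b' → b ≡ b'
mns-end-unique {b = b} {b'} m m' with <-cmp b b'
... | tri< b<b' _ _ = contradiction b<b' (mns-not-shorter m m')
... | tri≈ _ b≡b' _ = b≡b'
... | tri> _ _ b'<b = contradiction b'<b (mns-not-shorter m' m)

mns-fromStart : ∀ {d n a} → a ≤ n → StartsMNS d a → ∃[ b ] MNS d n a b
mns-fromStart {d} {n} {a} a≤n (da , leftMaximal) =
  extend (n ∸ a) a (trans (+-comm (n ∸ a) a) (m+[n∸m]≡n a≤n)) ≤-refl single
  where
  single : NegativeOn d a a
  single k a≤k k≤a with refl ← ≤-antisym a≤k k≤a = da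
  extend : ∀ r b → r + b ≡ n → a ≤ b → NegativeOn d a b → ∃[ b' ] MNS d n a b'
  extend zero    b refl a≤b negs = b , record
    { a≤b = a≤b ; b≤n = ≤-refl ; negative = negs ; leftMaximal = leftMaximal ; rightMaximal = inj₁ refl }
  extend (suc r) b r+b≡n a≤b negs with d (suc b) ≟ᴰ pos
  ... | yes d[1+b]≡pos = b , record
    { a≤b = a≤b ; b≤n = subst (b ≤_) r+b≡n (m≤n+m b (suc r)) ; negative = negs
    ; leftMaximal = leftMaximal ; rightMaximal = inj₂ d[1+b]≡pos }
  ... | no d[1+b]≢pos = extend r (suc b) (trans (+-suc r b) r+b≡n) (≤-trans a≤b (n≤1+n b)) negs′
    where
    negs′ : NegativeOn d a (suc b)
    negs′ k a≤k k≤1+b with m≤n⇒m<n∨m≡n k≤1+b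
    ... | inj₁ k<1+b = negs k a≤k (≤-pred k<1+b)
    ... | inj₂ refl with d (suc b)
    ...   | neg = refl
    ...   | pos = contradiction refl d[1+b]≢pos

mnsFrom : (ℕ → Dir) → ℕ → ℕ → ℕ
mnsFrom d n a = sum (map (λ b → if isMNS d n a b then 1 else 0) (upTo (suc n)))

mnsFrom-≤1 : ∀ d n a → mnsFrom d n a ≤ 1
mnsFrom-≤1 d n a = sum-map-≤1 (upTo⁺ (suc n)) (λ b → if-≤1 (isMNS d n a b))
  λ p q → mns-end-unique (T-isMNS {d} {n} {a} (if-positive⁻ p)) (T-isMNS (if-positive⁻ q))

mnsFrom-positive⁻ : ∀ {d n a} → 0 < mnsFrom d n a → ∃[ b ] MNS d n a b
mnsFrom-positive⁻ {n = n} 0<count =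
  let b , _ , 0<ind = sum-map-positive⁻ (upTo (suc n)) 0<count in b , T-isMNS (if-positive⁻ 0<ind)

mnsFrom-positive⁺ : ∀ {d n a b} → MNS d n a b → 0 < mnsFrom d n a
mnsFrom-positive⁺ m = sum-map-positive⁺ (∈-upTo⁺ (s≤s (MNS.b≤n m))) (if-positive⁺ (isMNS-T m))

Plateau : (ℕ → Dir) → ℕ → Set
Plateau d i = 1 ≤ i × d i ≡ d (i ∸ 1) × d i ≡ d (suc i)

plateau? : ∀ d i → Dec (Plateau d i)
plateau? d i = (1 ≤? i) ×-dec (d i ≟ᴰ d (i ∸ 1)) ×-dec (d i ≟ᴰ d (suc i))

OnlyChangesPlateaus : (ℕ → Dir) → (ℕ → Dir) → ℕ → Set
OnlyChangesPlateaus d d' n = ∀ i → i ≤ n → d i ≢ d' i → Plateau d' i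

unchanged : ∀ {d d' n i} → OnlyChangesPlateaus d d' n → i ≤ n → ¬ Plateau d' i → d i ≡ d' i
unchanged {d} {d'} {i = i} changes i≤n ¬plateau with d i ≟ᴰ d' i
... | yes di≡d'i = di≡d'i
... | no di≢d'i = contradiction (changes _ i≤n di≢d'i) ¬plateau

startsMNS-transfer : ∀ {d d' n} a → OnlyChangesPlateaus d d' n → a ≤ n → StartsMNS d' a → StartsMNS d a
startsMNS-transfer zero changes a≤n (d'0≡neg , _) = trans (unchanged changes a≤n λ ()) d'0≡neg , inj₁ refl
startsMNS-transfer {d' = d'} (suc a) changes a≤n (d'a≡neg , inj₂ d'a-1≡pos) =
  trans (unchanged changes a≤n ¬plateau-here) d'a≡neg ,
  inj₂ (trans (unchanged changes (≤-trans (n≤1+n a) a≤n) ¬plateau-before) d'a-1≡pos)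
  where
  ¬plateau-here : ¬ Plateau d' (suc a)
  ¬plateau-here (_ , flat , _) with () ← trans (sym d'a≡neg) (trans flat d'a-1≡pos)
  ¬plateau-before : ¬ Plateau d' a
  ¬plateau-before (_ , _ , flat) with () ← trans (sym d'a-1≡pos) (trans flat d'a≡neg)

mnsFrom-mono : ∀ {d d' n} → OnlyChangesPlateaus d d' n → ∀ a → mnsFrom d' n a ≤ mnsFrom d n a
mnsFrom-mono {d' = d'} {n} changes a with 1 ≤? mnsFrom d' n a
... | no ¬0<count = ≤-trans (≮⇒≥ ¬0<count) z≤n
... | yes 0<count =
  let _ , m' = mnsFrom-positive⁻ 0<count
      a≤n = ≤-trans (MNS.a≤b m') (MNS.b≤n m')
      _ , m = mns-fromStart a≤n (startsMNS-transfer a changes a≤n (mns-starts m'))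
  in ≤-trans (mnsFrom-≤1 d' n a) (mnsFrom-positive⁺ m)

numMNS-mono : ∀ {d d' n} → OnlyChangesPlateaus d d' n → numMNS d' n ≤ numMNS d n
numMNS-mono {n = n} changes = sum-map-mono (mnsFrom-mono changes) (upTo (suc n))

-- Entangled adjacencies

distinct-cover-pair : ∀ {u v x y z : ℕ} → (x ≡ u ⊎ x ≡ v) → (y ≡ u ⊎ y ≡ v) → x ≢ y →
                      (z ≡ u ⊎ z ≡ v) → z ≡ x ⊎ z ≡ y
distinct-cover-pair (inj₁ refl) (inj₁ refl) x≢y _           = contradiction refl x≢y
distinct-cover-pair (inj₁ refl) (inj₂ refl) _   (inj₁ refl) = inj₁ refl
distinct-cover-pair (inj₁ refl) (inj₂ refl) _   (inj₂ refl) = inj₂ refl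
distinct-cover-pair (inj₂ refl) (inj₁ refl) _   (inj₁ refl) = inj₂ refl
distinct-cover-pair (inj₂ refl) (inj₁ refl) _   (inj₂ refl) = inj₁ refl
distinct-cover-pair (inj₂ refl) (inj₂ refl) x≢y _           = contradiction refl x≢y

module _ (Gene Rep : Set) (r₀ : Rep) where
  open Chrom Gene Rep r₀ renaming (sym to _[_])

  rgt-injective : ∀ {s t} → rgt s ≡ rgt t → s ≡ t
  rgt-injective {plus , _}  {plus , _}  refl = refl
  rgt-injective {minus , _} {minus , _} refl = refl

  lft-injective : ∀ {s t} → lft s ≡ lft t → s ≡ t
  lft-injective {plus , _}  {plus , _}  refl = refl
  lft-injective {minus , _} {minus , _} refl = refl

  lft≢rgt : ∀ s → lft s ≢ rgt s
  lft≢rgt (plus , _) ()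
  lft≢rgt (minus , _) ()

  rgt≡lft⇒∣∣≡ : ∀ {s t} → rgt s ≡ lft t → ∣ s ∣ ≡ ∣ t ∣
  rgt≡lft⇒∣∣≡ {plus , _}  {minus , _} refl = refl
  rgt≡lft⇒∣∣≡ {minus , _} {plus , _}  refl = refl

  rgt≡lft⇒lft≡rgt : ∀ {s t} → rgt s ≡ lft t → lft s ≡ rgt t
  rgt≡lft⇒lft≡rgt {plus , _}  {minus , _} refl = refl
  rgt≡lft⇒lft≡rgt {minus , _} {plus , _}  refl = refl

  module EntangledPair (c : Chromosome) (occursTwice : ∀ r → OccursTwice c r)
                       {j : ℕ} (j≤n : j ≤ len c) (pair : rgt (c [ j ]) ≡ lft (c [ suc j ])) where

    j≤1+n : j ≤ suc (len c)
    j≤1+n = ≤-trans j≤n (n≤1+n _)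

    positions : ∀ {p} → p ≤ suc (len c) → ∣ c [ p ] ∣ ≡ ∣ c [ j ] ∣ → p ≡ j ⊎ p ≡ suc j
    positions {p} p≤ ∣p∣≡ with ∣ c [ j ] ∣ in ∣j∣≡
    ... | inj₁ g = let _ , _ , _ , once = genesOnce c g in
      contradiction (trans (once j j≤1+n ∣j∣≡) (sym (once (suc j) (s≤s j≤n) ∣1+j∣≡))) (<⇒≢ ≤-refl)
      where ∣1+j∣≡ = trans (sym (rgt≡lft⇒∣∣≡ pair)) ∣j∣≡
    ... | inj₂ r = let _ , _ , _ , _ , _ , _ , _ , twice = occursTwice r in
      distinct-cover-pair (twice j j≤1+n ∣j∣≡) (twice (suc j) (s≤s j≤n) (trans (sym (rgt≡lft⇒∣∣≡ pair)) ∣j∣≡))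
                          (<⇒≢ ≤-refl) (twice p p≤ ∣p∣≡)

    lft-unique : ∀ {p} → p ≤ suc (len c) → lft (c [ p ]) ≡ lft (c [ j ]) → p ≡ j
    lft-unique p≤ lft≡ with positions p≤ (cong ∣_∣ (lft-injective lft≡))
    ... | inj₁ p≡j  = p≡j
    ... | inj₂ refl = contradiction (sym (trans pair lft≡)) (lft≢rgt (c [ j ]))

    rgt-unique : ∀ {p} → p ≤ suc (len c) → rgt (c [ p ]) ≡ rgt (c [ suc j ]) → p ≡ suc j
    rgt-unique p≤ rgt≡ with positions p≤ (trans (cong ∣_∣ (rgt-injective rgt≡)) (sym (rgt≡lft⇒∣∣≡ pair)))
    ... | inj₁ refl = contradiction (trans (sym pair) rgt≡) (lft≢rgt (c [ suc j ]))
    ... | inj₂ p≡1+j = p≡1+j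

    interior : 1 ≤ len c → 1 ≤ j × suc j ≤ len c
    interior 1≤n = n≢0⇒n>0 j≢0 , j<n
      where
      endpoints : ∣ c [ 0 ] ∣ ≡ ∣ c [ suc (len c) ] ∣
      endpoints = trans (cong ∣_∣ (first c)) (sym (cong ∣_∣ (last c)))
      n≢0 : len c ≢ 0
      n≢0 n≡0 with () ← subst (1 ≤_) n≡0 1≤n
      j≢0 : j ≢ 0
      j≢0 refl with positions ≤-refl (sym endpoints)
      ... | inj₂ 1+n≡1 = n≢0 (suc-injective 1+n≡1)
      j<n : suc j ≤ len c
      j<n with m≤n⇒m<n∨m≡n j≤n
      ... | inj₁ j<n = j<n
      ... | inj₂ refl with positions z≤n (trans endpoints (sym (rgt≡lft⇒∣∣≡ pair)))
      ...   | inj₁ 0≡n = contradiction (sym 0≡n) n≢0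

  module EntangledAdjacency (π τ : Chromosome) (1≤n : 1 ≤ len π)
      (occursTwiceπ : ∀ r → OccursTwice π r) (occursTwiceτ : ∀ r → OccursTwice τ r)
      {i : ℕ} (i≤n : i ≤ len π) {j : ℕ} (j≤n : j ≤ len τ)
      (pairπ : rgt (π [ i ]) ≡ lft (π [ suc i ]))
      (rgt≡rgt : rgt (π [ i ]) ≡ rgt (τ [ j ]))
      (rgt≡lft : rgt (π [ i ]) ≡ lft (τ [ suc j ])) where

    module Pπ = EntangledPair π occursTwiceπ i≤n pairπ
    module Pτ = EntangledPair τ occursTwiceτ j≤n (trans (sym rgt≡rgt) rgt≡lft)

    first≡ : π [ i ] ≡ τ [ j ]
    first≡ = rgt-injective rgt≡rgt

    second≡ : π [ suc i ] ≡ τ [ suc j ]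
    second≡ = lft-injective (trans (sym pairπ) rgt≡lft)

    -- the extremity of the repeat not shared by the two copies
    outer : lft (π [ i ]) ≡ rgt (π [ suc i ])
    outer = rgt≡lft⇒lft≡rgt pairπ

    leftUntangled : ∀ {m} → suc m ≡ i → rgt (π [ m ]) ≢ lft (π [ suc m ])
    leftUntangled {m} refl e = <⇒≢ (n≤1+n _) (Pπ.rgt-unique (≤-trans (n≤1+n m) Pπ.j≤1+n) (trans e outer))

    rightUntangled : rgt (π [ suc i ]) ≢ lft (π [ suc (suc i) ])
    rightUntangled e =
      <⇒≢ (n≤1+n _) (sym (Pπ.lft-unique {suc (suc i)} (s≤s (proj₂ (Pπ.interior 1≤n))) (sym (trans outer e))))

    leftNeighbour : ∀ {m k} → suc m ≡ i → k ≤ len τ → adj π m ≈ᵤ adj τ k →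
                    (Positive π τ m × suc k ≡ j) ⊎ (Negative π τ m × k ≡ suc j)
    leftNeighbour refl k≤n (inj₁ (rgt≡ , lft≡)) = inj₁
      ( (_ , k≤n , rgt≡ , lft≡ , leftUntangled refl)
      , Pτ.lft-unique (s≤s k≤n) (trans (sym lft≡) (cong lft first≡)) )
    leftNeighbour refl k≤n (inj₂ (rgt≡ , lft≡)) = inj₂
      ( (_ , k≤n , rgt≡ , lft≡ , leftUntangled refl)
      , Pτ.rgt-unique (≤-trans k≤n (n≤1+n _)) (trans (sym lft≡) (trans outer (cong rgt second≡))) )

    rightNeighbour : ∀ {k} → k ≤ len τ → adj π (suc i) ≈ᵤ adj τ k →
                     (Positive π τ (suc i) × k ≡ suc j) ⊎ (Negative π τ (suc i) × suc k ≡ j)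
    rightNeighbour k≤n (inj₁ (rgt≡ , lft≡)) = inj₁
      ( (_ , k≤n , rgt≡ , lft≡ , rightUntangled)
      , Pτ.rgt-unique (≤-trans k≤n (n≤1+n _)) (trans (sym rgt≡) (cong rgt second≡)) )
    rightNeighbour k≤n (inj₂ (rgt≡ , lft≡)) = inj₂
      ( (_ , k≤n , rgt≡ , lft≡ , rightUntangled)
      , Pτ.lft-unique (s≤s k≤n) (trans (sym rgt≡) (trans (sym outer) (cong lft first≡))) )

    sameDirection-of-distinct : ∀ {m k₁ k₂} → k₁ ≢ k₂ →
      (Positive π τ m × suc k₁ ≡ j) ⊎ (Negative π τ m × k₁ ≡ suc j) →
      (Positive π τ (suc i) × k₂ ≡ suc j) ⊎ (Negative π τ (suc i) × suc k₂ ≡ j) →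
      SameDirection π τ m (suc i)
    sameDirection-of-distinct _ (inj₁ (p , _)) (inj₁ (q , _)) = inj₁ (p , q)
    sameDirection-of-distinct _ (inj₂ (p , _)) (inj₂ (q , _)) = inj₂ (p , q)
    sameDirection-of-distinct k₁≢k₂ (inj₁ (_ , 1+k₁≡j)) (inj₂ (_ , 1+k₂≡j)) =
      contradiction (suc-injective (trans 1+k₁≡j (sym 1+k₂≡j))) k₁≢k₂
    sameDirection-of-distinct k₁≢k₂ (inj₂ (_ , k₁≡1+j)) (inj₁ (_ , k₂≡1+j)) =
      contradiction (trans k₁≡1+j (sym k₂≡1+j)) k₁≢k₂

    neighbours-sameDirection : SameAdjacencies π τ → SameDirection π τ (i ∸ 1) (suc i)
    neighbours-sameDirection (f , g , matched , _) with Pπ.interior 1≤n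
    ... | s≤s {n = m} z≤n , 1+i≤n
      with k₁≤n , gk₁≡m , adj₁ ← matched m (≤-trans (n≤1+n m) i≤n)
      with k₂≤n , gk₂≡2+m , adj₂ ← matched (suc i) 1+i≤n
      = sameDirection-of-distinct (λ e → <⇒≢ (n≤1+n _) (trans (sym gk₁≡m) (trans (cong g e) gk₂≡2+m)))
          (leftNeighbour refl k₁≤n adj₁) (rightNeighbour k₂≤n adj₂)

  entangled-neighbours : ∀ π τ → 1 ≤ len π → SameAdjacencies π τ →
                         (∀ r → OccursTwice π r) → (∀ r → OccursTwice τ r) →
                         ∀ {i} → i ≤ len π → Entangled π τ i →
                         1 ≤ i × suc i ≤ len π × SameDirection π τ (i ∸ 1) (suc i)
  entangled-neighbours π τ 1≤n sameAdj occursTwiceπ occursTwiceτ i≤n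
                       (j , j≤n , pairπ , rgt≡rgt , rgt≡lft) =
    let 1≤i , 1+i≤n = Pπ.interior 1≤n in 1≤i , 1+i≤n , neighbours-sameDirection sameAdj
    where open EntangledAdjacency π τ 1≤n occursTwiceπ occursTwiceτ i≤n j≤n pairπ rgt≡rgt rgt≡lft

  positive-or-negative : ∀ π τ → SameAdjacencies π τ → ∀ {i} → i ≤ len π → ¬ Entangled π τ i →
                         Positive π τ i ⊎ Negative π τ i
  positive-or-negative π τ (_ , _ , matched , _) i≤n ¬entangled with matched _ i≤n
  ... | k≤n , _ , inj₁ (rgt≡ , lft≡) =
    inj₁ (_ , k≤n , rgt≡ , lft≡ , λ e → ¬entangled (_ , k≤n , e , rgt≡ , trans e lft≡))
  ... | k≤n , _ , inj₂ (rgt≡ , lft≡) =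
    inj₂ (_ , k≤n , rgt≡ , lft≡ , λ e → ¬entangled (_ , k≤n , e , trans e lft≡ , rgt≡))

  validAssignments-agree : ∀ π τ {d d'} → SameAdjacencies π τ →
                           ValidAssignment π τ d → ValidAssignment π τ d' →
                           ∀ {i} → i ≤ len π → ¬ Entangled π τ i → d i ≡ d' i
  validAssignments-agree π τ sameAdj valid valid' {i} i≤n ¬entangled
    with positive-or-negative π τ sameAdj i≤n ¬entangled
  ... | inj₁ p = trans (proj₁ (valid i i≤n) p) (sym (proj₁ (valid' i i≤n) p))
  ... | inj₂ q = trans (proj₂ (valid i i≤n) q) (sym (proj₂ (valid' i i≤n) q))

  followingNeighbours-onlyChangesPlateaus :
    ∀ π τ {d d'} → 1 ≤ len π → SameAdjacencies π τ →
    (∀ r → OccursTwice π r) → (∀ r → OccursTwice τ r) →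
    ValidAssignment π τ d → ValidAssignment π τ d' → FollowsNeighbours π τ d' →
    OnlyChangesPlateaus d d' (len π)
  followingNeighbours-onlyChangesPlateaus π τ {d} {d'} 1≤n sameAdj occursTwiceπ occursTwiceτ
                                          valid valid' follows i i≤n di≢d'i =
    -- equality of extremities is undecidable, so entanglement can only be refuted, not decided
    decidable-stable (plateau? d' i) λ ¬plateau →
      di≢d'i (validAssignments-agree π τ sameAdj valid valid' i≤n λ entangled →
        ¬plateau (proj₁ (entangled-neighbours π τ 1≤n sameAdj occursTwiceπ occursTwiceτ i≤n entangled)
                 , follows i i≤n entangled))

proposition2 : (Gene Rep : Set) (r₀ : Rep) →
    let open Chrom Gene Rep r₀ in
    (π τ : Chromosome) →
    1 ≤ len π →
    Simple π → Simple τ →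
    SameAdjacencies π τ →
    ((r : Rep) → OccursTwice π r) →
    ((r : Rep) → OccursTwice τ r) →
    ((r : Rep) → ContainsBothSigns τ r) →
    ((i : ℕ) → i ≤ len π → Entangled π τ i →
       1 ≤ i × suc i ≤ len π × SameDirection π τ (i ∸ 1) (suc i))
    ×
    ((d d' : ℕ → Dir) →
       ValidAssignment π τ d →
       ValidAssignment π τ d' → FollowsNeighbours π τ d' →
       numMNS d' (len π) ≤ numMNS d (len π))
proposition2 Gene Rep r₀ π τ 1≤n _ _ sameAdj occursTwiceπ occursTwiceτ _ =
  (λ i → entangled-neighbours Gene Rep r₀ π τ 1≤n sameAdj occursTwiceπ occursTwiceτ) ,
  λ d d' valid valid' follows → numMNS-mono
    (followingNeighbours-onlyChangesPlateaus Gene Rep r₀ π τ 1≤n sameAdj occursTwiceπ occursTwiceτ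
                                             valid valid' follows)
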